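{- Let $1\le i\le n$ and assume $O_i\neq\emptyset$. Then the set $\mathbb{O}_i\cup\{o_i\}$ contains an optimal option for $F[i]$, i.e. some $j\in \mathbb{O}_i\cup\{o_i\}$ attains the minimum defining $F[i]$. Consequently, $$F[i]=\min\{F[j]+S_{j+1,i} : j\in \mathbb{O}_i\cup\{o_i\}\}.$$
   Context: Items $1,\ldots,n$ with weights $w_i\ge0$ and parameters $s_i\ge 0$, and a threshold $w_0$. Write $W_{a,b}=\sum_{a\le v\le b} w_v$ and $S_{a,b}=\max\{s_v : a\le v\le b\}$. Let $F[0]=0$ and for $1\le i\le n$, $F[i]=\min\{F[j]+S_{j+1,i}: 0\le j<i,\ W_{j+1,i}\le w_0\}$ (minimum over the empty set is $+\infty$); $F[i]$ is the minimum, over all partitions of $1,\ldots,i$ into consecutive intervals each of total weight at most $w_0$, of the sum over intervals of the maximum $s_v$ in the interval. For $1\le i\le n$ let $O_i=\{j : 0\le j<i,\ W_{j+1,i}\le w_0\}$ (the options of $i$), $o_i=\min O_i$, and let $\mathbb{O}_i=\{j\in O_i : j>0,\ s_j>S_{j+1,i}\}$ (the s-maximal options of $i$). An option $j\in O_i$ is optimal for $F[i]$ if $F[j]+S_{j+1,i}=F[i]$.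
   Formalization: The weights $w_i$, the parameters $s_i$ and the threshold $w_0$ are rational numbers. -}

module Defs where

open import Data.Nat as ℕ using (ℕ; zero; suc; _∸_)
open import Data.Bool using (Bool; true; false; if_then_else_)
open import Data.Maybe using (Maybe; just; nothing)
open import Data.List using (List; []; _∷_; map; upTo; foldr)
open import Data.Rational using (ℚ; 0ℚ; _+_; _⊔_; _≤_; _⊓_)
open import Data.Rational.Properties using (_≤?_)
open import Relation.Nullary.Decidable using (⌊_⌋)
open import Data.Product using (_×_)
open import Data.Sum using (_⊎_)
open import Data.Unit using (⊤)
open import Data.Empty using (⊥)

-- Items are indexed by positive naturals; w v, s v are the weight and
-- parameter of item v (values at indices outside 1..n are irrelevant).

range : ℕ → ℕ → List ℕ
range a b = map (a ℕ.+_) (upTo (suc b ∸ a))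

W : (ℕ → ℚ) → ℕ → ℕ → ℚ
W w a b = foldr (λ v acc → w v + acc) 0ℚ (range a b)

-- S_{a,b} = max of s v for a ≤ v ≤ b (only used with a ≤ b; the value 0 for
-- the empty range is harmless since all s v ≥ 0)
S : (ℕ → ℚ) → ℕ → ℕ → ℚ
S s a b = foldr (λ v acc → s v ⊔ acc) 0ℚ (range a b)

-- ℚ extended with +∞ (nothing = +∞)
ℚ∞ : Set
ℚ∞ = Maybe ℚ

_+∞_ : ℚ∞ → ℚ → ℚ∞
just x +∞ y = just (x + y)
nothing +∞ y = nothing

min∞ : ℚ∞ → ℚ∞ → ℚ∞
min∞ nothing y = y
min∞ (just x) nothing = just x
min∞ (just x) (just y) = just (x ⊓ y)

minOver : List ℕ → (ℕ → ℚ∞) → ℚ∞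
minOver js f = foldr (λ j acc → min∞ (f j) acc) nothing js

step : (w s : ℕ → ℚ) (w0 : ℚ) → ℕ → (ℕ → ℚ∞) → ℚ∞
step w s w0 i G =
  minOver (upTo i) (λ j → if ⌊ W w (suc j) i ≤? w0 ⌋
                          then G j +∞ S s (suc j) i
                          else nothing)

-- Fupto k j = F[j] for all j ≤ k
Fupto : (w s : ℕ → ℚ) (w0 : ℚ) → ℕ → ℕ → ℚ∞
Fupto w s w0 zero j = just 0ℚ
Fupto w s w0 (suc k) j =
  if ⌊ j ℕ.≤? k ⌋ then Fupto w s w0 k j else step w s w0 (suc k) (Fupto w s w0 k)

F : (w s : ℕ → ℚ) (w0 : ℚ) → ℕ → ℚ∞
F w s w0 i = Fupto w s w0 i i

IsOption : (w : ℕ → ℚ) (w0 : ℚ) (i j : ℕ) → Set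
IsOption w w0 i j = (j ℕ.< i) × (W w (suc j) i ≤ w0)

IsLeastOption : (w : ℕ → ℚ) (w0 : ℚ) (i j : ℕ) → Set
IsLeastOption w w0 i j = IsOption w w0 i j × (∀ k → IsOption w w0 i k → j ℕ.≤ k)

IsSMaximalOption : (w s : ℕ → ℚ) (w0 : ℚ) (i j : ℕ) → Set
IsSMaximalOption w s w0 i j =
  IsOption w w0 i j × (0 ℕ.< j) × (S s (suc j) i Data.Rational.< s j)

_≤∞_ : ℚ∞ → ℚ∞ → Set
_ ≤∞ nothing = ⊤
nothing ≤∞ just y = ⊥
just x ≤∞ just y = x ≤ y

-- F is nondecreasing (an option of i+1 other than i is an option of i, with
-- a smaller interval maximum), and the options of i form an interval [o_i, i).
-- Take any optimal option j.  If j is neither o_i nor s-maximal, then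
-- s_j ≤ S_{j+1,i}, so S_{j,i} = S_{j+1,i}, and j-1 is again an option with
-- F[j-1] + S_{j,i} ≤ F[j] + S_{j+1,i}; hence j-1 is optimal as well.
-- Descending in this way ends in 𝕆_i ∪ {o_i}.
module Submission where

open import Defs
open import Data.Nat using (ℕ; _≤_)
open import Data.Rational using (ℚ; 0ℚ)
open import Data.Product using (Σ; _×_; ∃)
open import Data.Sum using (_⊎_)
open import Relation.Binary.PropositionalEquality using (_≡_)

open import Data.Bool using (if_then_else_)
open import Data.Empty using (⊥-elim)
open import Data.List using ([]; _∷_; _∷ʳ_; map; foldr; upTo; applyUpTo)
open import Data.List.Properties using (map-upTo; map-∘; map-cong; upTo-∷ʳ; map-++; foldr-∷ʳ)
open import Data.List.Membership.Propositional using (_∈_)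
open import Data.List.Membership.Propositional.Properties using (∈-upTo⁺; ∈-upTo⁻)
open import Data.List.Relation.Unary.Any using (here; there)
open import Data.Maybe using (just; nothing)
open import Data.Nat as ℕ using (suc; zero; z≤n; s≤s; s≤s⁻¹; _<_; _∸_; _+_; _≤′_; ≤′-refl; ≤′-step)
import Data.Nat.Properties as ℕ
import Data.Rational as ℚ
import Data.Rational.Properties as ℚ
open import Data.Product using (_,_; proj₂)
open import Function using (_∘_)
open import Data.Sum using (inj₁; inj₂)
open import Data.Unit using (tt)
open import Relation.Binary.PropositionalEquality using (_≢_; refl; sym; trans; cong; cong₂; subst; module ≡-Reasoning)
open import Relation.Nullary using (yes; no)
open import Relation.Nullary.Decidable using (⌊_⌋)

≤∞-refl : ∀ x → x ≤∞ x
≤∞-refl nothing  = tt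
≤∞-refl (just x) = ℚ.≤-refl

≤∞-reflexive : ∀ {x y} → x ≡ y → x ≤∞ y
≤∞-reflexive {x} refl = ≤∞-refl x

≤∞-trans : ∀ {x y z} → x ≤∞ y → y ≤∞ z → x ≤∞ z
≤∞-trans {z = nothing}                    _ _ = tt
≤∞-trans {y = nothing} {just _}           _ ()
≤∞-trans {nothing}     {just _} {just _}  () _
≤∞-trans {just _}      {just _} {just _}  p q = ℚ.≤-trans p q

≤∞-antisym : ∀ {x y} → x ≤∞ y → y ≤∞ x → x ≡ y
≤∞-antisym {nothing} {nothing} _ _ = refl
≤∞-antisym {nothing} {just _}  () _
≤∞-antisym {just _}  {nothing} _ ()
≤∞-antisym {just _}  {just _}  p q = cong just (ℚ.≤-antisym p q)

+∞-monoˡ-≤∞ : ∀ {x y} q → x ≤∞ y → (x +∞ q) ≤∞ (y +∞ q)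
+∞-monoˡ-≤∞ {y = nothing}           _ _  = tt
+∞-monoˡ-≤∞ {nothing} {just _}      _ ()
+∞-monoˡ-≤∞ {just _}  {just _}      q p  = ℚ.+-monoˡ-≤ q p

+∞-monoʳ-≤∞ : ∀ x {q r} → q ℚ.≤ r → (x +∞ q) ≤∞ (x +∞ r)
+∞-monoʳ-≤∞ nothing  _ = tt
+∞-monoʳ-≤∞ (just x) p = ℚ.+-monoʳ-≤ x p

x≤∞x+∞q : ∀ x {q} → 0ℚ ℚ.≤ q → x ≤∞ (x +∞ q)
x≤∞x+∞q nothing  _ = tt
x≤∞x+∞q (just x) {q} p = subst (ℚ._≤ x ℚ.+ q) (ℚ.+-identityʳ x) (ℚ.+-monoʳ-≤ x p)

min∞-lbˡ : ∀ x y → min∞ x y ≤∞ x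
min∞-lbˡ nothing  _        = tt
min∞-lbˡ (just x) nothing  = ℚ.≤-refl
min∞-lbˡ (just x) (just y) = ℚ.p⊓q≤p x y

min∞-lbʳ : ∀ x y → min∞ x y ≤∞ y
min∞-lbʳ nothing  y        = ≤∞-refl y
min∞-lbʳ (just x) nothing  = tt
min∞-lbʳ (just x) (just y) = ℚ.p⊓q≤q x y

min∞-glb : ∀ {z} x y → z ≤∞ x → z ≤∞ y → z ≤∞ min∞ x y
min∞-glb          nothing  _        _  q = q
min∞-glb          (just _) nothing  p  _ = p
min∞-glb {nothing} (just _) (just _) () _
min∞-glb {just _}  (just _) (just _) p  q = ℚ.⊓-glb p q

min∞-sel : ∀ x y → min∞ x y ≡ x ⊎ min∞ x y ≡ y
min∞-sel nothing  _       = inj₂ refl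
min∞-sel (just _) nothing = inj₁ refl
min∞-sel (just x) (just y) with ℚ.⊓-sel x y
... | inj₁ e = inj₁ (cong just e)
... | inj₂ e = inj₂ (cong just e)

minOver-≤∞ : ∀ {xs} f {x} → x ∈ xs → minOver xs f ≤∞ f x
minOver-≤∞ {x ∷ xs} f (here refl) = min∞-lbˡ (f x) (minOver xs f)
minOver-≤∞ {y ∷ xs} f (there x∈xs) =
  ≤∞-trans (min∞-lbʳ (f y) (minOver xs f)) (minOver-≤∞ f x∈xs)

minOver-glb : ∀ xs f {z} → (∀ x → x ∈ xs → z ≤∞ f x) → z ≤∞ minOver xs f
minOver-glb []       f lb = tt
minOver-glb (x ∷ xs) f lb =
  min∞-glb (f x) (minOver xs f) (lb x (here refl)) (minOver-glb xs f (λ y y∈xs → lb y (there y∈xs)))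

minOver-cong : ∀ xs {f g} → (∀ x → x ∈ xs → f x ≡ g x) → minOver xs f ≡ minOver xs g
minOver-cong []       eq = refl
minOver-cong (x ∷ xs) eq = cong₂ min∞ (eq x (here refl)) (minOver-cong xs (λ y y∈xs → eq y (there y∈xs)))

minOver-attained : ∀ xs f → minOver xs f ≡ nothing ⊎ Σ ℕ (λ y → y ∈ xs × minOver xs f ≡ f y)
minOver-attained []       f = inj₁ refl
minOver-attained (x ∷ xs) f with min∞-sel (f x) (minOver xs f) | minOver-attained xs f
... | inj₁ e | _                  = inj₂ (x , here refl , e)
... | inj₂ e | inj₁ e′            = inj₁ (trans e e′)
... | inj₂ e | inj₂ (y , y∈xs , e′) = inj₂ (y , there y∈xs , trans e e′)

range-∷ : ∀ {a b} → a ≤ b → range a b ≡ a ∷ range (suc a) b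
range-∷ {a} {b} a≤b = begin
  map (a +_) (upTo (suc b ∸ a))           ≡⟨ cong (λ d → map (a +_) (upTo d)) (ℕ.+-∸-assoc 1 a≤b) ⟩
  a + 0 ∷ map (a +_) (applyUpTo suc d)    ≡⟨ cong₂ _∷_ (ℕ.+-identityʳ a) (cong (map (a +_)) (sym (map-upTo suc d))) ⟩
  a ∷ map (a +_) (map suc (upTo d))       ≡⟨ cong (a ∷_) (sym (map-∘ (upTo d))) ⟩
  a ∷ map (λ k → a + suc k) (upTo d)      ≡⟨ cong (a ∷_) (map-cong (ℕ.+-suc a) (upTo d)) ⟩
  a ∷ range (suc a) b                     ∎
  where
  open ≡-Reasoning
  d : ℕ
  d = b ∸ a

range-∷ʳ : ∀ {a b} → a ≤ suc b → range a (suc b) ≡ range a b ∷ʳ suc b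
range-∷ʳ {a} {b} a≤1+b = begin
  map (a +_) (upTo (suc (suc b) ∸ a))     ≡⟨ cong (λ d → map (a +_) (upTo d)) (ℕ.+-∸-assoc 1 a≤1+b) ⟩
  map (a +_) (upTo (suc d))               ≡⟨ cong (map (a +_)) (sym (upTo-∷ʳ d)) ⟩
  map (a +_) (upTo d ∷ʳ d)                ≡⟨ map-++ (a +_) (upTo d) (d ∷ []) ⟩
  range a b ∷ʳ (a + d)                    ≡⟨ cong (range a b ∷ʳ_) (ℕ.m+[n∸m]≡n a≤1+b) ⟩
  range a b ∷ʳ suc b                      ∎
  where
  open ≡-Reasoning
  d : ℕ
  d = suc b ∸ a

foldr-monoʳ-≤ : (g : ℕ → ℚ → ℚ) → (∀ v {x y} → x ℚ.≤ y → g v x ℚ.≤ g v y) →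
                ∀ xs {e e′} → e ℚ.≤ e′ → foldr g e xs ℚ.≤ foldr g e′ xs
foldr-monoʳ-≤ g mono []       e≤e′ = e≤e′
foldr-monoʳ-≤ g mono (x ∷ xs) e≤e′ = mono x (foldr-monoʳ-≤ g mono xs e≤e′)

foldr-range-extendʳ : (g : ℕ → ℚ → ℚ) → (∀ v {x y} → x ℚ.≤ y → g v x ℚ.≤ g v y) →
                      ∀ {a b} → a ≤ suc b → 0ℚ ℚ.≤ g (suc b) 0ℚ →
                      foldr g 0ℚ (range a b) ℚ.≤ foldr g 0ℚ (range a (suc b))
foldr-range-extendʳ g mono {a} {b} a≤1+b 0≤g = begin
  foldr g 0ℚ (range a b)                   ≤⟨ foldr-monoʳ-≤ g mono (range a b) 0≤g ⟩
  foldr g (g (suc b) 0ℚ) (range a b)       ≡⟨ foldr-∷ʳ g 0ℚ (suc b) (range a b) ⟨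
  foldr g 0ℚ (range a b ∷ʳ suc b)          ≡⟨ cong (foldr g 0ℚ) (range-∷ʳ a≤1+b) ⟨
  foldr g 0ℚ (range a (suc b))             ∎
  where open ℚ.≤-Reasoning

W-extendʳ : ∀ w {a b} → a ≤ suc b → 0ℚ ℚ.≤ w (suc b) → W w a b ℚ.≤ W w a (suc b)
W-extendʳ w a≤1+b 0≤w = foldr-range-extendʳ (λ v acc → w v ℚ.+ acc) (λ v → ℚ.+-monoʳ-≤ (w v)) a≤1+b
  (subst (0ℚ ℚ.≤_) (sym (ℚ.+-identityʳ _)) 0≤w)

S-extendʳ : ∀ s {a b} → a ≤ suc b → S s a b ℚ.≤ S s a (suc b)
S-extendʳ s a≤1+b = foldr-range-extendʳ (λ v acc → s v ℚ.⊔ acc) (λ v → ℚ.⊔-monoʳ-≤ (s v)) a≤1+b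
  (ℚ.p≤q⊔p (s (suc _)) 0ℚ)

W-∷ : ∀ w {a b} → a ≤ b → W w a b ≡ w a ℚ.+ W w (suc a) b
W-∷ w a≤b = cong (foldr (λ v acc → w v ℚ.+ acc) 0ℚ) (range-∷ a≤b)

S-∷ : ∀ s {a b} → a ≤ b → S s a b ≡ s a ℚ.⊔ S s (suc a) b
S-∷ s a≤b = cong (foldr (λ v acc → s v ℚ.⊔ acc) 0ℚ) (range-∷ a≤b)

W-dropˡ : ∀ w {a b} → a ≤ b → 0ℚ ℚ.≤ w a → W w (suc a) b ℚ.≤ W w a b
W-dropˡ w {a} {b} a≤b 0≤w = begin
  W w (suc a) b          ≡⟨ ℚ.+-identityˡ _ ⟨
  0ℚ ℚ.+ W w (suc a) b   ≤⟨ ℚ.+-monoˡ-≤ _ 0≤w ⟩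
  w a ℚ.+ W w (suc a) b  ≡⟨ W-∷ w a≤b ⟨
  W w a b                ∎
  where open ℚ.≤-Reasoning

S-nonneg : ∀ s a b → 0ℚ ℚ.≤ S s a b
S-nonneg s a b = go (range a b)
  where
  go : ∀ xs → 0ℚ ℚ.≤ foldr (λ v acc → s v ℚ.⊔ acc) 0ℚ xs
  go []       = ℚ.≤-refl
  go (x ∷ xs) = ℚ.≤-trans (go xs) (ℚ.p≤q⊔p (s x) _)

module _ (w s : ℕ → ℚ) (w0 : ℚ) where

  F[_] : ℕ → ℚ∞
  F[ i ] = F w s w0 i

  candidate : ℕ → (ℕ → ℚ∞) → ℕ → ℚ∞
  candidate i G j = if ⌊ W w (suc j) i ℚ.≤? w0 ⌋ then G j +∞ S s (suc j) i else nothing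

  candidate-fits : ∀ i G j → W w (suc j) i ℚ.≤ w0 → candidate i G j ≡ G j +∞ S s (suc j) i
  candidate-fits i G j fits with W w (suc j) i ℚ.≤? w0
  ... | yes _    = refl
  ... | no ¬fits = ⊥-elim (¬fits fits)

  Fupto-below : ∀ {k j} → j ≤ k → Fupto w s w0 (suc k) j ≡ Fupto w s w0 k j
  Fupto-below {k} {j} j≤k with j ℕ.≤? k
  ... | yes _   = refl
  ... | no j≰k  = ⊥-elim (j≰k j≤k)

  Fupto≡F : ∀ {k j} → j ≤ k → Fupto w s w0 k j ≡ F[ j ]
  Fupto≡F {zero}  z≤n = refl
  Fupto≡F {suc k} j≤1+k with ℕ.m≤n⇒m<n∨m≡n j≤1+k
  ... | inj₂ refl      = refl
  ... | inj₁ (s≤s j≤k) = trans (Fupto-below j≤k) (Fupto≡F j≤k)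

  F-suc : ∀ k → F[ suc k ] ≡ minOver (upTo (suc k)) (candidate (suc k) F[_])
  F-suc k = trans unfold (minOver-cong (upTo (suc k)) λ j j∈ →
    cong (λ x → candidate (suc k) (λ _ → x) j) (Fupto≡F (s≤s⁻¹ (∈-upTo⁻ j∈))))
    where
    unfold : F[ suc k ] ≡ step w s w0 (suc k) (Fupto w s w0 k)
    unfold with suc k ℕ.≤? k
    ... | yes 1+k≤k = ⊥-elim (ℕ.<-irrefl refl 1+k≤k)
    ... | no _      = refl

  F≤∞-option : ∀ {i j} → IsOption w w0 i j → F[ i ] ≤∞ (F[ j ] +∞ S s (suc j) i)
  F≤∞-option {suc k} {j} (j<1+k , fits) = subst (_≤∞ (F[ j ] +∞ S s (suc j) (suc k))) (sym (F-suc k))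
    (≤∞-trans (minOver-≤∞ (candidate (suc k) F[_]) (∈-upTo⁺ j<1+k)) (≤∞-reflexive (candidate-fits (suc k) F[_] j fits)))

  -- By F≤∞-option, an option j is optimal for F[i] exactly when it satisfies this inequality.
  Optimal : ℕ → ℕ → Set
  Optimal i j = (F[ j ] +∞ S s (suc j) i) ≤∞ F[ i ]

  optimal-if-infinite : ∀ {i j} → F[ i ] ≡ nothing → Optimal i j
  optimal-if-infinite {i} {j} e = subst ((F[ j ] +∞ S s (suc j) i) ≤∞_) (sym e) tt

  optimal-option-exists : ∀ {i j} → IsOption w w0 i j → Σ ℕ λ k → IsOption w w0 i k × Optimal i k
  optimal-option-exists {suc i′} {j} j-opt with minOver-attained (upTo (suc i′)) (candidate (suc i′) F[_])
  ... | inj₁ e = j , j-opt , optimal-if-infinite {suc i′} {j} (trans (F-suc i′) e)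
  ... | inj₂ (k , k∈ , e) with W w (suc k) (suc i′) ℚ.≤? w0
  ...   | yes fits = k , (∈-upTo⁻ k∈ , fits) ,
                     ≤∞-reflexive (sym (trans (F-suc i′) e))
  ...   | no _     = j , j-opt , optimal-if-infinite {suc i′} {j} (trans (F-suc i′) e)

  IsSMaximalOrLeastOption : ℕ → ℕ → Set
  IsSMaximalOrLeastOption i j = IsSMaximalOption w s w0 i j ⊎ IsLeastOption w w0 i j

  SMaximalOrLeast⇒option : ∀ {i j} → IsSMaximalOrLeastOption i j → IsOption w w0 i j
  SMaximalOrLeast⇒option (inj₁ (opt , _)) = opt
  SMaximalOrLeast⇒option (inj₂ (opt , _)) = opt

  module _ {n : ℕ} (w-nonneg : ∀ v → 1 ≤ v → v ≤ n → 0ℚ ℚ.≤ w v) where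

    F-mono : ∀ {m} → suc m ≤ n → F[ m ] ≤∞ F[ suc m ]
    F-mono {m} 1+m≤n = subst (F[ m ] ≤∞_) (sym (F-suc m)) (minOver-glb (upTo (suc m)) _ lb)
      where
      lb : ∀ k → k ∈ upTo (suc m) → F[ m ] ≤∞ candidate (suc m) F[_] k
      lb k k∈ with W w (suc k) (suc m) ℚ.≤? w0
      ... | no _     = tt
      ... | yes fits = via (ℕ.m≤n⇒m<n∨m≡n (s≤s⁻¹ (∈-upTo⁻ k∈)))
        where
        via : k < m ⊎ k ≡ m → F[ m ] ≤∞ (F[ k ] +∞ S s (suc k) (suc m))
        via (inj₂ refl) = x≤∞x+∞q F[ m ] (S-nonneg s (suc m) (suc m))
        via (inj₁ k<m)  = ≤∞-trans (F≤∞-option (k<m , ℚ.≤-trans W-shorter fits))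
                                   (+∞-monoʳ-≤∞ F[ k ] (S-extendʳ s (s≤s (ℕ.<⇒≤ k<m))))
          where
          W-shorter : W w (suc k) m ℚ.≤ W w (suc k) (suc m)
          W-shorter = W-extendʳ w (s≤s (ℕ.<⇒≤ k<m)) (w-nonneg (suc m) (s≤s z≤n) 1+m≤n)

    option-between : ∀ {i o m} → i ≤ n → IsOption w w0 i o → o ≤ m → m < i → IsOption w w0 i m
    option-between {i} i≤n o-opt o≤m = go (ℕ.≤⇒≤′ o≤m)
      where
      go : ∀ {m} → _ ≤′ m → m < i → IsOption w w0 i m
      go ≤′-refl _ = o-opt
      go {suc m} (≤′-step o≤′m) 1+m<i = 1+m<i , ℚ.≤-trans
        (W-dropˡ w (ℕ.<⇒≤ 1+m<i) (w-nonneg (suc m) (s≤s z≤n) (ℕ.≤-trans (ℕ.<⇒≤ 1+m<i) i≤n)))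
        (proj₂ (go o≤′m (ℕ.<-trans (ℕ.n<1+n m) 1+m<i)))

    least-option : ∀ {i} → i ≤ n → ∀ {j} → IsOption w w0 i j → Σ ℕ (IsLeastOption w w0 i)
    least-option     i≤n {zero}  opt = 0 , opt , λ _ _ → z≤n
    least-option {i} i≤n {suc m} opt@(1+m<i , _) with W w (suc m) i ℚ.≤? w0
    ... | yes fits = least-option i≤n (ℕ.<-trans (ℕ.n<1+n m) 1+m<i , fits)
    ... | no ¬fits = suc m , opt , λ k k-opt → ℕ.≮⇒≥ λ k<1+m →
      ¬fits (proj₂ (option-between i≤n k-opt (s≤s⁻¹ k<1+m) (ℕ.<-trans (ℕ.n<1+n m) 1+m<i)))

    optimal-predecessor : ∀ {i o m} → i ≤ n → IsLeastOption w w0 i o → o ≢ suc m →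
                          IsOption w w0 i (suc m) → s (suc m) ℚ.≤ S s (suc (suc m)) i →
                          Optimal i (suc m) → IsOption w w0 i m × Optimal i m
    optimal-predecessor {i} {o} {m} i≤n (o-opt , o-least) o≢1+m opt@(1+m<i , _) s≤S optimal =
      option-between i≤n o-opt (s≤s⁻¹ (ℕ.≤∧≢⇒< (o-least _ opt) o≢1+m)) (ℕ.<-trans (ℕ.n<1+n m) 1+m<i) ,
      ≤∞-trans (+∞-monoˡ-≤∞ (S s (suc m) i) (F-mono (ℕ.≤-trans (ℕ.<⇒≤ 1+m<i) i≤n)))
               (subst (λ x → (F[ suc m ] +∞ x) ≤∞ F[ i ]) (sym S-unchanged) optimal)
      where
      S-unchanged : S s (suc m) i ≡ S s (suc (suc m)) i
      S-unchanged = trans (S-∷ s (ℕ.<⇒≤ 1+m<i)) (ℚ.p≤q⇒p⊔q≡q s≤S)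

    descend : ∀ {i o} → i ≤ n → IsLeastOption w w0 i o → ∀ {j} → IsOption w w0 i j → Optimal i j →
              Σ ℕ λ k → IsSMaximalOrLeastOption i k × Optimal i k
    descend i≤n o-least {zero} opt optimal = 0 , inj₂ (opt , λ _ _ → z≤n) , optimal
    descend {i} {o} i≤n o-least {suc m} opt optimal with S s (suc (suc m)) i ℚ.<? s (suc m) | o ℕ.≟ suc m
    ... | yes s-max | _         = suc m , inj₁ (opt , s≤s z≤n , s-max) , optimal
    ... | no _      | yes refl  = o , inj₂ o-least , optimal
    ... | no ¬s-max | no o≢1+m  =
      let m-opt , m-optimal = optimal-predecessor i≤n o-least o≢1+m opt (ℚ.≮⇒≥ ¬s-max) optimal
      in descend i≤n o-least m-opt m-optimal

lemma1 : (n : ℕ) (w s : ℕ → ℚ) (w0 : ℚ)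
           → (∀ v → 1 ≤ v → v ≤ n → Data.Rational._≤_ 0ℚ (w v))
           → (∀ v → 1 ≤ v → v ≤ n → Data.Rational._≤_ 0ℚ (s v))
           → (i : ℕ) → 1 ≤ i → i ≤ n
           → ∃ (λ j → IsOption w w0 i j)
           → Σ ℕ (λ j → (IsSMaximalOption w s w0 i j ⊎ IsLeastOption w w0 i j)
                        × (F w s w0 j +∞ S s (Data.Nat.suc j) i ≡ F w s w0 i))
             × (∀ j → IsSMaximalOption w s w0 i j ⊎ IsLeastOption w w0 i j
                    → F w s w0 i ≤∞ (F w s w0 j +∞ S s (Data.Nat.suc j) i))
lemma1 n w s w0 w-nonneg _ i _ i≤n (j , j-opt) =
  let _  , o-least                   = least-option w s w0 w-nonneg i≤n j-opt
      j′ , j′-opt , j′-optimal       = optimal-option-exists w s w0 j-opt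
      k  , k-distinguished , k-optimal = descend w s w0 w-nonneg i≤n o-least j′-opt j′-optimal
  in (k , k-distinguished , ≤∞-antisym k-optimal (lower-bound k-distinguished)) , λ _ → lower-bound
  where
  lower-bound : ∀ {k} → IsSMaximalOrLeastOption w s w0 i k → F w s w0 i ≤∞ (F w s w0 k +∞ S s (suc k) i)
  lower-bound = F≤∞-option w s w0 ∘ SMaximalOrLeast⇒option w s w0
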